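{- Let $n$ be a positive integer, let $i$ be an integer with $1\le i\le \lceil n/2\rceil$, let $c>4$ be a constant, and let $t$ be an integer with $n^2/c\le t\le n^2/4$. Then \[ \Pr_{w\sim\mathcal{W}(i)}\Big[\min_{0\le r\le t} w^{(r)}\ge 1\Big]\ge e^{ -1-c}\cdot\frac{i}{n}. \]
   Context: $\mathcal{W}(i)$ denotes a simple symmetric random walk $(w^{(0)},w^{(1)},\dots)$ on $\mathbb{Z}$ with $w^{(0)}=i$ and independent $\pm1$ steps, each with probability $1/2$.
   Formalization: The constant $c>4$ ranges over the rationals. -}

module Defs where

open import Data.Bool using (Bool; true; false)
open import Data.Nat as ℕ using (ℕ; zero; suc)
open import Data.Integer as ℤ using (ℤ; +_)
open import Data.Vec using (Vec; []; _∷_)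
open import Data.List using (List; []; _∷_; map; _++_; length; filter)
open import Data.Product using (Σ; _×_; _,_)
open import Relation.Nullary using (Dec; yes; no)
open import Data.Rational as ℚ using (ℚ)

step : Bool → ℤ
step true  = + 1
step false = ℤ.- (+ 1)

-- All 2^t step sequences of length t (explicit enumeration; each has
-- probability 2^-t under the simple symmetric random walk).
allSeqs : (t : ℕ) → List (Vec Bool t)
allSeqs zero    = [] ∷ []
allSeqs (suc t) = map (true ∷_) (allSeqs t) ++ map (false ∷_) (allSeqs t)

StaysPositive : ℤ → {t : ℕ} → Vec Bool t → Set
StaysPositive w []      = + 1 ℤ.≤ w
StaysPositive w (b ∷ s) = (+ 1 ℤ.≤ w) × StaysPositive (w ℤ.+ step b) s

staysPositive? : (w : ℤ) {t : ℕ} (s : Vec Bool t) → Dec (StaysPositive w s)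
staysPositive? w []      = + 1 ℤ.≤? w
staysPositive? w (b ∷ s) with + 1 ℤ.≤? w | staysPositive? (w ℤ.+ step b) s
... | yes p | yes q = yes (p , q)
... | no ¬p | _     = no λ { (p , _) → ¬p p }
... | yes _ | no ¬q = no λ { (_ , q) → ¬q q }

-- Number of length-t step sequences for which the walk from i stays ≥ 1
-- during steps 0..t.  Pr[min_{0≤r≤t} w^(r) ≥ 1] = goodCount i t / 2^t.
goodCount : ℤ → ℕ → ℕ
goodCount w t = length (filter (staysPositive? w) (allSeqs t))

expTerm : ℚ → ℕ → ℚ
expTerm y zero    = ℚ.1ℚ
expTerm y (suc k) = expTerm y k ℚ.* y ℚ.* (+ 1 ℚ./ suc k)

expPartial : ℚ → ℕ → ℚ
expPartial y zero    = ℚ.0ℚ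
expPartial y (suc N) = expPartial y N ℚ.+ expTerm y N

-- For a ≥ 0 (here: a = 0 ≤ p) and y ≥ 0 the partial sums increase to e^y, so
-- "a ≤ p · e^y" holds iff for every ε > 0 some partial sum satisfies
-- a ≤ p · S_N(y) + ε.
_≤_·exp_ : ℚ → ℚ → ℚ → Set
a ≤ p ·exp y = (ε : ℚ) → ℚ.0ℚ ℚ.< ε →
  Σ ℕ λ N → a ℚ.≤ p ℚ.* expPartial y N ℚ.+ ε

module Submission where

-- Let P t x count the length-t step sequences keeping the walk from x positive, so that
-- P (t+1) (x+1) = P t (x+2) + P t x and P t 0 = 0.  Averaging over one step leaves 2n²x
-- unchanged and raises x³ by 3x, hence by induction on t
--   2^t (2n²x − x³ − 3tx) ≤ 2n³ P t x,
-- the case t = 0 being 2n²x ≤ 2n³ + x³.  For x = i ≤ n and 4t ≤ n² the left side is at least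
-- 2^t n² i / 4, so the survival probability is at least i / (8n); and 8 ≤ 1 + 5 + 5²/2 ≤ e^(1+c)
-- because c > 4.

open import Defs
open import Data.Nat as ℕ using (ℕ; _^_; _*_; _/_)
open import Data.Integer using (+_)
open import Data.Rational as ℚ using (ℚ)

open import Data.Nat using (zero; suc; _+_; _≤_; _∸_; z≤n; s≤s)
import Data.Nat.Properties as ℕ
open import Data.Nat.DivMod using (m/n<m)
open import Data.Nat.Tactic.RingSolver using (solve-∀)
import Data.Integer as ℤ
import Data.Integer.Properties as ℤ
open import Data.Rational using (mkℚ; *≤*)
import Data.Rational.Properties as ℚ
import Data.Nat.Coprimality as Coprime
open import Data.Bool using (Bool; true; false)
open import Data.Vec using (Vec; _∷_)
open import Data.List using (List; []; _∷_; map; _++_; length; filter)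
open import Data.List.Properties using (filter-++; length-++)
open import Data.Product using (_,_)
open import Data.Empty using (⊥-elim)
open import Relation.Nullary using (yes; no)
open import Relation.Nullary.Decidable using (toWitness)
open import Relation.Binary.PropositionalEquality

survivors : ℕ → ℕ → ℕ
survivors x = goodCount (+ x)

filter-staysPositive-cons : ∀ w b {t} (ss : List (Vec Bool t)) → + 1 ℤ.≤ w →
  length (filter (staysPositive? w) (map (b ∷_) ss)) ≡
  length (filter (staysPositive? (w ℤ.+ step b)) ss)
filter-staysPositive-cons w b []       1≤w = refl
filter-staysPositive-cons w b (s ∷ ss) 1≤w with + 1 ℤ.≤? w | staysPositive? (w ℤ.+ step b) s
... | no 1≰w | _     = ⊥-elim (1≰w 1≤w)
... | yes _  | yes _ = cong suc (filter-staysPositive-cons w b ss 1≤w)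
... | yes _  | no _  = filter-staysPositive-cons w b ss 1≤w

survivors-suc : ∀ k t → survivors (suc k) (suc t) ≡ survivors (suc (suc k)) t + survivors k t
survivors-suc k t = begin
  length (filter P (map (true ∷_) ss ++ map (false ∷_) ss))
    ≡⟨ cong length (filter-++ P (map (true ∷_) ss) (map (false ∷_) ss)) ⟩
  length (filter P (map (true ∷_) ss) ++ filter P (map (false ∷_) ss))
    ≡⟨ length-++ (filter P (map (true ∷_) ss)) ⟩
  length (filter P (map (true ∷_) ss)) + length (filter P (map (false ∷_) ss))
    ≡⟨ cong₂ _+_ (filter-staysPositive-cons (+ suc k) true ss 1≤1+k)
                 (filter-staysPositive-cons (+ suc k) false ss 1≤1+k) ⟩
  goodCount (+ suc k ℤ.+ + 1) t + survivors k t
    ≡⟨ cong (λ m → survivors m t + survivors k t) (ℕ.+-comm (suc k) 1) ⟩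
  survivors (suc (suc k)) t + survivors k t ∎
  where
  open ≡-Reasoning
  P = staysPositive? (+ suc k)
  ss = allSeqs t
  1≤1+k = ℤ.+≤+ (s≤s z≤n)

2n²x≤2n³+x³ : ∀ n x → 2 * (n * n) * x ≤ 2 * (n * n * n) + x * x * x
2n²x≤2n³+x³ n x with x ℕ.≤? n
... | yes x≤n = begin
  2 * (n * n) * x     ≤⟨ ℕ.*-monoʳ-≤ (2 * (n * n)) x≤n ⟩
  2 * (n * n) * n     ≡⟨ reassoc n ⟩
  2 * (n * n * n)     ≤⟨ ℕ.m≤m+n _ (x * x * x) ⟩
  2 * (n * n * n) + x * x * x ∎
  where
  open ℕ.≤-Reasoning
  reassoc : ∀ n → 2 * (n * n) * n ≡ 2 * (n * n * n)
  reassoc = solve-∀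
... | no x≰n rewrite sym (ℕ.m+[n∸m]≡n (ℕ.<⇒≤ (ℕ.≰⇒> x≰n))) = begin
  2 * (n * n) * (n + d)
    ≤⟨ ℕ.m≤m+n _ (n * n * n + n * n * d + 3 * n * d * d + d * d * d) ⟩
  2 * (n * n) * (n + d) + (n * n * n + n * n * d + 3 * n * d * d + d * d * d)
    ≡⟨ expand n d ⟩
  2 * (n * n * n) + (n + d) * (n + d) * (n + d) ∎
  where
  open ℕ.≤-Reasoning
  d = x ∸ n
  expand : ∀ n d → 2 * (n * n) * (n + d) + (n * n * n + n * n * d + 3 * n * d * d + d * d * d)
                 ≡ 2 * (n * n * n) + (n + d) * (n + d) * (n + d)
  expand = solve-∀

survivors-potential : ∀ n t x →
  2 ^ t * (2 * (n * n) * x) ≤ 2 * (n * n * n) * survivors x t + 2 ^ t * (3 * t * x + x * x * x)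
survivors-potential n t zero = begin
  2 ^ t * (2 * (n * n) * 0) ≡⟨ cong (2 ^ t *_) (ℕ.*-zeroʳ (2 * (n * n))) ⟩
  2 ^ t * 0                 ≡⟨ ℕ.*-zeroʳ (2 ^ t) ⟩
  0                         ≤⟨ z≤n ⟩
  _                         ∎
  where open ℕ.≤-Reasoning
survivors-potential n zero x@(suc _) = begin
  1 * (2 * (n * n) * x)                     ≡⟨ ℕ.*-identityˡ _ ⟩
  2 * (n * n) * x                           ≤⟨ 2n²x≤2n³+x³ n x ⟩
  2 * (n * n * n) + x * x * x               ≡⟨ tidy n x ⟩
  2 * (n * n * n) * 1 + 1 * (3 * 0 * x + x * x * x) ∎
  where
  open ℕ.≤-Reasoning
  tidy : ∀ n x → 2 * (n * n * n) + x * x * x ≡ 2 * (n * n * n) * 1 + 1 * (3 * 0 * x + x * x * x)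
  tidy = solve-∀
survivors-potential n (suc t) (suc k) = begin
  2 ^ suc t * (2 * (n * n) * suc k)
    ≡⟨ split-linear (2 ^ t) n k ⟩
  2 ^ t * (2 * (n * n) * suc (suc k)) + 2 ^ t * (2 * (n * n) * k)
    ≤⟨ ℕ.+-mono-≤ (survivors-potential n t (suc (suc k))) (survivors-potential n t k) ⟩
  (2 * (n * n * n) * a + 2 ^ t * (3 * t * suc (suc k) + suc (suc k) * suc (suc k) * suc (suc k)))
    + (2 * (n * n * n) * b + 2 ^ t * (3 * t * k + k * k * k))
    ≡⟨ merge-cubic (2 ^ t) n t k a b ⟩
  2 * (n * n * n) * (a + b) + 2 ^ suc t * (3 * suc t * suc k + suc k * suc k * suc k)
    ≡⟨ cong (λ g → 2 * (n * n * n) * g + 2 ^ suc t * (3 * suc t * suc k + suc k * suc k * suc k))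
            (sym (survivors-suc k t)) ⟩
  2 * (n * n * n) * survivors (suc k) (suc t) + 2 ^ suc t * (3 * suc t * suc k + suc k * suc k * suc k)
    ∎
  where
  open ℕ.≤-Reasoning
  a = survivors (suc (suc k)) t
  b = survivors k t
  split-linear : ∀ p n k → 2 * p * (2 * (n * n) * suc k)
               ≡ p * (2 * (n * n) * suc (suc k)) + p * (2 * (n * n) * k)
  split-linear = solve-∀
  -- (k + 2)³ + k³ = 2 (k + 1)³ + 6 (k + 1): averaging the cube produces the 3x per step.
  merge-cubic : ∀ p n t k a b →
    (2 * (n * n * n) * a + p * (3 * t * suc (suc k) + suc (suc k) * suc (suc k) * suc (suc k)))
      + (2 * (n * n * n) * b + p * (3 * t * k + k * k * k))
    ≡ 2 * (n * n * n) * (a + b) + 2 * p * (3 * suc t * suc k + suc k * suc k * suc k)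
  merge-cubic = solve-∀

survivors-lowerBound : ∀ n i t → i ≤ n → 4 * t ≤ n * n → i * 2 ^ t ≤ n * survivors i t * 8
survivors-lowerBound zero      .zero t z≤n _      = z≤n
survivors-lowerBound n@(suc _) i     t i≤n 4t≤n² =
  ℕ.*-cancelˡ-≤ (n * n) (ℕ.+-cancelʳ-≤ (p * (7 * (n * n) * i)) _ _ (begin
    n * n * (i * p) + p * (7 * (n * n) * i)
      ≡⟨ scale-left p n i ⟩
    4 * (p * (2 * (n * n) * i))
      ≤⟨ ℕ.*-monoʳ-≤ 4 (survivors-potential n t i) ⟩
    4 * (2 * (n * n * n) * G + p * (3 * t * i + i * i * i))
      ≡⟨ scale-right p n i t G ⟩
    n * n * (n * G * 8) + p * (3 * i * (4 * t) + 4 * (i * (i * i)))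
      ≤⟨ ℕ.+-monoʳ-≤ (n * n * (n * G * 8)) (ℕ.*-monoʳ-≤ p (ℕ.+-mono-≤ drift cube)) ⟩
    n * n * (n * G * 8) + p * (3 * i * (n * n) + 4 * (i * (n * n)))
      ≡⟨ cong (n * n * (n * G * 8) ℕ.+_) (collect p n i) ⟩
    n * n * (n * G * 8) + p * (7 * (n * n) * i) ∎))
  where
  open ℕ.≤-Reasoning
  p = 2 ^ t
  G = survivors i t
  drift : 3 * i * (4 * t) ≤ 3 * i * (n * n)
  drift = ℕ.*-monoʳ-≤ (3 * i) 4t≤n²
  cube : 4 * (i * (i * i)) ≤ 4 * (i * (n * n))
  cube = ℕ.*-monoʳ-≤ 4 (ℕ.*-monoʳ-≤ i (ℕ.*-mono-≤ i≤n i≤n))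
  scale-left : ∀ p n i → n * n * (i * p) + p * (7 * (n * n) * i) ≡ 4 * (p * (2 * (n * n) * i))
  scale-left = solve-∀
  scale-right : ∀ p n i t G → 4 * (2 * (n * n * n) * G + p * (3 * t * i + i * i * i))
              ≡ n * n * (n * G * 8) + p * (3 * i * (4 * t) + 4 * (i * (i * i)))
  scale-right = solve-∀
  collect : ∀ p n i → p * (3 * i * (n * n) + 4 * (i * (n * n))) ≡ p * (7 * (n * n) * i)
  collect = solve-∀

ι : ℕ → ℚ
ι m = + m ℚ./ 1

ι≡mkℚ : ∀ m → ι m ≡ mkℚ (+ m) 0 (Coprime.sym (Coprime.1-coprimeTo m))
ι≡mkℚ m = ℚ.normalize-coprime (Coprime.sym (Coprime.1-coprimeTo m))

ι-mono-≤ : ∀ {m n} → m ≤ n → ι m ℚ.≤ ι n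
ι-mono-≤ {m} {n} m≤n rewrite ι≡mkℚ m | ι≡mkℚ n =
  *≤* (subst₂ ℤ._≤_ (sym (ℤ.*-identityʳ (+ m))) (sym (ℤ.*-identityʳ (+ n))) (ℤ.+≤+ m≤n))

ι-homo-* : ∀ m n → ι (m * n) ≡ ι m ℚ.* ι n
ι-homo-* m n rewrite ι≡mkℚ m | ι≡mkℚ n = cong (ℚ._/ 1) (ℤ.pos-* m n)

ι-nonNeg : ∀ m → ℚ.0ℚ ℚ.≤ ι m
ι-nonNeg m = ι-mono-≤ {0} {m} z≤n

*-mono-≤-nonNeg : ∀ {p q r s} → ℚ.0ℚ ℚ.≤ p → ℚ.0ℚ ℚ.≤ r → p ℚ.≤ q → r ℚ.≤ s → p ℚ.* r ℚ.≤ q ℚ.* s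
*-mono-≤-nonNeg {p} {q} {r} {s} 0≤p 0≤r p≤q r≤s = begin
  p ℚ.* r ≤⟨ ℚ.*-monoʳ-≤-nonNeg r {{ℚ.nonNegative 0≤r}} p≤q ⟩
  q ℚ.* r ≤⟨ ℚ.*-monoˡ-≤-nonNeg q {{ℚ.nonNegative (ℚ.≤-trans 0≤p p≤q)}} r≤s ⟩
  q ℚ.* s ∎
  where open ℚ.≤-Reasoning

*-nonNeg : ∀ {p q} → ℚ.0ℚ ℚ.≤ p → ℚ.0ℚ ℚ.≤ q → ℚ.0ℚ ℚ.≤ p ℚ.* q
*-nonNeg {p} {q} 0≤p 0≤q = ℚ.nonNegative⁻¹ _
  {{ℚ.nonNeg*nonNeg⇒nonNeg p {{ℚ.nonNegative 0≤p}} q {{ℚ.nonNegative 0≤q}}}}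

1/n-nonNeg : ∀ n .{{_ : ℕ.NonZero n}} → ℚ.0ℚ ℚ.≤ + 1 ℚ./ n
1/n-nonNeg n = ℚ.nonNegative⁻¹ _ {{ℚ.normalize-nonNeg 1 n}}

expTerm-nonNeg : ∀ {x} k → ℚ.0ℚ ℚ.≤ x → ℚ.0ℚ ℚ.≤ expTerm x k
expTerm-nonNeg zero    0≤x = ℚ.nonNegative⁻¹ ℚ.1ℚ
expTerm-nonNeg (suc k) 0≤x = *-nonNeg (*-nonNeg (expTerm-nonNeg k 0≤x) 0≤x) (1/n-nonNeg (suc k))

expTerm-mono-≤ : ∀ {x y} k → ℚ.0ℚ ℚ.≤ x → x ℚ.≤ y → expTerm x k ℚ.≤ expTerm y k
expTerm-mono-≤ zero    0≤x x≤y = ℚ.≤-refl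
expTerm-mono-≤ (suc k) 0≤x x≤y =
  ℚ.*-monoʳ-≤-nonNeg (+ 1 ℚ./ suc k) {{ℚ.nonNegative (1/n-nonNeg (suc k))}}
    (*-mono-≤-nonNeg (expTerm-nonNeg k 0≤x) 0≤x (expTerm-mono-≤ k 0≤x x≤y) x≤y)

expPartial-mono-≤ : ∀ {x y} N → ℚ.0ℚ ℚ.≤ x → x ℚ.≤ y → expPartial x N ℚ.≤ expPartial y N
expPartial-mono-≤ zero    0≤x x≤y = ℚ.≤-refl
expPartial-mono-≤ (suc N) 0≤x x≤y = ℚ.+-mono-≤ (expPartial-mono-≤ N 0≤x x≤y) (expTerm-mono-≤ N 0≤x x≤y)

8≤expPartial-3 : ∀ {y} → ι 5 ℚ.≤ y → ι 8 ℚ.≤ expPartial y 3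
8≤expPartial-3 5≤y = ℚ.≤-trans (toWitness {a? = ι 8 ℚ.≤? expPartial (ι 5) 3} _)
                                (expPartial-mono-≤ 3 (ι-nonNeg 5) 5≤y)

≤·exp-intro : ∀ {a p y} N → a ℚ.≤ p ℚ.* expPartial y N → a ≤ p ·exp y
≤·exp-intro {a} {p} {y} N a≤pS ε 0<ε = N , (begin
  a                            ≤⟨ a≤pS ⟩
  p ℚ.* expPartial y N         ≡⟨ sym (ℚ.+-identityʳ _) ⟩
  p ℚ.* expPartial y N ℚ.+ ℚ.0ℚ ≤⟨ ℚ.+-monoʳ-≤ (p ℚ.* expPartial y N) (ℚ.<⇒≤ 0<ε) ⟩
  p ℚ.* expPartial y N ℚ.+ ε   ∎)
  where open ℚ.≤-Reasoning

mainTheorem7 : (n i : ℕ) (c : ℚ) (t : ℕ) →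
    1 ℕ.≤ n → 1 ℕ.≤ i → i ℕ.≤ (n ℕ.+ 1) / 2 →
    (+ 4 ℚ./ 1) ℚ.< c →
    (+ (n * n) ℚ./ 1) ℚ.≤ c ℚ.* (+ t ℚ./ 1) →
    4 * t ℕ.≤ n * n →
    (+ (i * 2 ^ t) ℚ./ 1) ≤ (+ (n * goodCount (+ i) t) ℚ./ 1) ·exp (ℚ.1ℚ ℚ.+ c)
mainTheorem7 n@(suc _) i c t _ _ i≤[n+1]/2 4<c _ 4t≤n² = ≤·exp-intro {p = ι (n * G)} 3 (begin
  ι (i * 2 ^ t)        ≤⟨ ι-mono-≤ (survivors-lowerBound n i t i≤n 4t≤n²) ⟩
  ι (n * G * 8)        ≡⟨ ι-homo-* (n * G) 8 ⟩
  ι (n * G) ℚ.* ι 8    ≤⟨ ℚ.*-monoˡ-≤-nonNeg (ι (n * G)) {{ℚ.nonNegative (ι-nonNeg (n * G))}}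
                            (8≤expPartial-3 5≤1+c) ⟩
  ι (n * G) ℚ.* expPartial (ℚ.1ℚ ℚ.+ c) 3 ∎)
  where
  open ℚ.≤-Reasoning
  G = survivors i t
  i≤n : i ≤ n
  i≤n = ℕ.m<1+n⇒m≤n (ℕ.≤-<-trans i≤[n+1]/2
          (subst ((n ℕ.+ 1) / 2 ℕ.<_) (ℕ.+-comm n 1) (m/n<m (n ℕ.+ 1) 2 (s≤s (s≤s z≤n)))))
  5≤1+c : ι 5 ℚ.≤ ℚ.1ℚ ℚ.+ c
  5≤1+c = ℚ.≤-trans (toWitness {a? = ι 5 ℚ.≤? ℚ.1ℚ ℚ.+ ι 4} _) (ℚ.+-monoʳ-≤ ℚ.1ℚ (ℚ.<⇒≤ 4<c))
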